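{- Let $m,n\geq 1$ and let $D$ be a $2$-dominating set of the grid graph $G_{m,n}$. Then $|D\cap C_1|\geq \lceil m/3\rceil$ and $|D\cap C_n|\geq \lceil m/3\rceil$, where $C_j=\{(i,j)\mid i\in[m]\}$.
   Context: For a graph $G$, a set $D\subseteq V(G)$ is a $2$-dominating set if every vertex not in $D$ has at least $2$ neighbours in $D$. The grid graph $G_{m,n}=P_m\times P_n$ has vertex set $[m]\times[n]$ (where $[k]=\{1,\dots,k\}$), with $(i,j)$ and $(i',j')$ adjacent iff $|i-i'|+|j-j'|=1$. For $j\in[n]$, the $j$-th column is $C_j=\{(i,j)\mid i\in[m]\}$. -}

module Defs where

open import Data.Nat using (ℕ; zero; suc; _+_; _≤_; _∸_)
open import Data.Nat.DivMod using (_/_)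
open import Data.Bool using (Bool; true; false; T)
open import Data.Fin using (Fin; toℕ)
open import Data.Fin.Subset using (Subset; _∈_; _∉_; ∣_∣)
open import Data.Product using (_×_; _,_)
open import Data.List using (List; length; filter; allFin; cartesianProduct)
open import Relation.Binary.PropositionalEquality using (_≡_)
open import Relation.Nullary using (Dec; yes; no; ¬_)
open import Relation.Nullary.Decidable using (_×-dec_)
import Data.Nat as ℕ
import Data.Vec as Vec

dist : ℕ → ℕ → ℕ
dist a b = (a ∸ b) + (b ∸ a)

-- Vertices of the grid graph G_{m,n} = P_m × P_n: pairs (i , j), i ∈ [m], j ∈ [n]
-- (0-indexed via Fin).
Vertex : ℕ → ℕ → Set
Vertex m n = Fin m × Fin n

Adj : ∀ {m n} → Vertex m n → Vertex m n → Set
Adj (i , j) (i' , j') = dist (toℕ i) (toℕ i') + dist (toℕ j) (toℕ j') ≡ 1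

VSet : ℕ → ℕ → Set
VSet m n = Fin m → Fin n → Bool

_∈D_ : ∀ {m n} → Vertex m n → VSet m n → Set
(i , j) ∈D D = T (D i j)

allVertices : ∀ m n → List (Vertex m n)
allVertices m n = cartesianProduct (allFin m) (allFin n)

nbrsIn : ∀ {m n} → VSet m n → Vertex m n → ℕ
nbrsIn {m} {n} D v =
  length (filter (λ u → (dist' u ℕ.≟ 1) ×-dec Data.Bool._≟_ (D (Data.Product.proj₁ u) (Data.Product.proj₂ u)) true) (allVertices m n))
  where
  import Data.Bool
  import Data.Product
  dist' : Vertex m n → ℕ
  dist' (i' , j') = dist (toℕ (Data.Product.proj₁ v)) (toℕ i') + dist (toℕ (Data.Product.proj₂ v)) (toℕ j')

TwoDominating : ∀ {m n} → VSet m n → Set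
TwoDominating {m} {n} D = (v : Vertex m n) → ¬ (v ∈D D) → 2 ≤ nbrsIn D v

colCount : ∀ {m n} → VSet m n → Fin n → ℕ
colCount {m} D j = length (filter (λ i → Data.Bool._≟_ (D i j) true) (allFin m))
  where import Data.Bool

ceil3 : ℕ → ℕ
ceil3 m = (m + 2) / 3

-- Let h be the column C_j of D, read as a subset of the path P_m. If C_j is a boundary column,
-- a vertex (i , j) ∉ D has only one neighbour outside C_j, so 2-domination forces one of its
-- neighbours inside C_j into D: h dominates the path. Each vertex of h dominates at most
-- three vertices of the path (itself and its two path neighbours), so m ≤ 3 |h|.
module Submission where

open import Defs
open import Data.Bool using (Bool; true; false; T; _∨_; T?)
import Data.Bool as Bool
open import Data.Bool.Properties using (T-∨)
open import Data.Empty using (⊥-elim)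
open import Data.Fin using (Fin; zero; suc; fromℕ; toℕ)
open import Data.Fin.Properties using (toℕ-injective; toℕ-fromℕ; toℕ≤pred[n]; any?)
open import Data.List using (List; []; _∷_; length; filter; tabulate)
open import Data.List.Properties using (filter-none)
import Data.List.Relation.Unary.All as All
open import Data.List.Relation.Unary.AllPairs using (_∷_)
open import Data.List.Relation.Unary.Unique.Propositional using (Unique)
open import Data.List.Relation.Unary.Unique.Propositional.Properties using (cartesianProduct⁺; allFin⁺)
open import Data.Nat using (ℕ; zero; suc; _+_; _*_; _∸_; _≤_; z≤n; s≤s; s≤s⁻¹)
import Data.Nat as ℕ
open import Data.Nat.DivMod using (m<n*o⇒m/o<n)
open import Data.Nat.Properties
open import Algebra.Properties.CommutativeSemigroup +-commutativeSemigroup using (interchange)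
open import Data.Product using (_×_; _,_; ∃-syntax)
open import Data.Sum using (_⊎_; inj₁; inj₂)
open import Data.Unit using (tt)
open import Function using (_∘_)
open import Function.Bundles using (Equivalence)
open import Relation.Binary.PropositionalEquality
open import Relation.Nullary using (yes; no)
open import Relation.Nullary.Decidable using (_×-dec_)
open import Relation.Unary using (Decidable)

dist-zeroˡ : ∀ n → dist 0 n ≡ n
dist-zeroˡ zero    = refl
dist-zeroˡ (suc n) = refl

dist≡0⇒≡ : ∀ m n → dist m n ≡ 0 → m ≡ n
dist≡0⇒≡ m n e =
  ≤-antisym (m∸n≡0⇒m≤n (m+n≡0⇒m≡0 (m ∸ n) e)) (m∸n≡0⇒m≤n (m+n≡0⇒n≡0 (m ∸ n) e))

toℕ-dist≡0⇒≡ : ∀ {N} {a b : Fin N} → dist (toℕ a) (toℕ b) ≡ 0 → a ≡ b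
toℕ-dist≡0⇒≡ e = toℕ-injective (dist≡0⇒≡ _ _ e)

dist≡1⇒suc≡ : ∀ m n → n ≤ m → dist m n ≡ 1 → suc n ≡ m
dist≡1⇒suc≡ m n n≤m e = begin
  1 + n          ≡⟨ cong (_+ n) m∸n≡1 ⟨
  (m ∸ n) + n    ≡⟨ m∸n+n≡m n≤m ⟩
  m              ∎
  where
  open ≡-Reasoning
  m∸n≡1 : m ∸ n ≡ 1
  m∸n≡1 = begin
    m ∸ n             ≡⟨ +-identityʳ (m ∸ n) ⟨
    (m ∸ n) + 0       ≡⟨ cong ((m ∸ n) +_) (m≤n⇒m∸n≡0 n≤m) ⟨
    (m ∸ n) + (n ∸ m) ≡⟨ e ⟩
    1                 ∎

m+n≡1-cases : ∀ m n → m + n ≡ 1 → (m ≡ 1 × n ≡ 0) ⊎ (m ≡ 0 × n ≡ 1)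
m+n≡1-cases zero          n e = inj₂ (refl , e)
m+n≡1-cases (suc zero)    n e = inj₁ (refl , suc-injective e)
m+n≡1-cases (suc (suc m)) n ()

length-filter≤1 : ∀ {A : Set} {P : A → Set} (P? : Decidable P) {xs : List A} → Unique xs →
                  (∀ {x y} → P x → P y → x ≡ y) → length (filter P? xs) ≤ 1
length-filter≤1 P? {[]}     _          _        = z≤n
length-filter≤1 P? {x ∷ xs} (x∉xs ∷ u) P-unique with P? x
... | yes px = s≤s (≤-reflexive (cong length (filter-none P? (All.map (λ x≢y → x≢y ∘ P-unique px) x∉xs))))
... | no  _  = length-filter≤1 P? u P-unique

bit : Bool → ℕ
bit true  = 1
bit false = 0

bit-∨ : ∀ x y → bit (x ∨ y) ≤ bit x + bit y
bit-∨ true  y = s≤s z≤n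
bit-∨ false y = ≤-refl

count : ∀ {N} → (Fin N → Bool) → ℕ
count {zero}  h = 0
count {suc N} h = bit (h zero) + count (h ∘ suc)

length-filter-tabulate : ∀ {A : Set} {N} (p : A → Bool) (t : Fin N → A) →
                         length (filter (λ x → p x Bool.≟ true) (tabulate t)) ≡ count (p ∘ t)
length-filter-tabulate {N = zero}  p t = refl
length-filter-tabulate {N = suc N} p t with p (t zero)
... | true  = cong suc (length-filter-tabulate p (t ∘ suc))
... | false = length-filter-tabulate p (t ∘ suc)

count-all : ∀ {N} (h : Fin N → Bool) → (∀ i → T (h i)) → count h ≡ N
count-all {zero}  h all = refl
count-all {suc N} h all with h zero | all zero
... | true | _ = cong suc (count-all (h ∘ suc) (all ∘ suc))

count-∨ : ∀ {N} (f g : Fin N → Bool) → count (λ i → f i ∨ g i) ≤ count f + count g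
count-∨ {zero}  f g = z≤n
count-∨ {suc N} f g = ≤-trans (+-mono-≤ (bit-∨ (f zero) (g zero)) (count-∨ (f ∘ suc) (g ∘ suc)))
  (≤-reflexive (interchange (bit (f zero)) (bit (g zero)) (count (f ∘ suc)) (count (g ∘ suc))))

shiftLeft : ∀ {N} → (Fin N → Bool) → Fin N → Bool
shiftLeft {suc zero}    h zero    = false
shiftLeft {suc (suc N)} h zero    = h (suc zero)
shiftLeft {suc (suc N)} h (suc i) = shiftLeft (h ∘ suc) i

-- shiftRight b h i = h (i - 1), reading b at i = 0; the carried bit keeps ∼⇒shift structural.
shiftRight : ∀ {N} → Bool → (Fin N → Bool) → Fin N → Bool
shiftRight b h zero    = b
shiftRight b h (suc i) = shiftRight (h zero) (h ∘ suc) i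

count-shiftLeft≡ : ∀ {N} (h : Fin (suc N) → Bool) → count (shiftLeft h) ≡ count (h ∘ suc)
count-shiftLeft≡ {zero}  h = refl
count-shiftLeft≡ {suc N} h = cong (bit (h (suc zero)) +_) (count-shiftLeft≡ (h ∘ suc))

count-shiftLeft : ∀ {N} (h : Fin N → Bool) → count (shiftLeft h) ≤ count h
count-shiftLeft {zero}  h = z≤n
count-shiftLeft {suc N} h = ≤-trans (≤-reflexive (count-shiftLeft≡ h)) (m≤n+m _ (bit (h zero)))

count-shiftRight : ∀ {N} b (h : Fin N → Bool) → count (shiftRight b h) ≤ bit b + count h
count-shiftRight {zero}  b h = z≤n
count-shiftRight {suc N} b h = +-monoʳ-≤ (bit b) (count-shiftRight (h zero) (h ∘ suc))

_∼_ : ∀ {N} → Fin N → Fin N → Set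
i ∼ i' = dist (toℕ i) (toℕ i') ≡ 1

∼⇒shift : ∀ {N} b (h : Fin N → Bool) {i i' : Fin N} → i ∼ i' → T (h i') →
          T (shiftLeft h i ∨ shiftRight b h i)
∼⇒shift               b h {zero}        {zero}         ()
∼⇒shift               b h {zero}        {suc (suc i')} ()
∼⇒shift               b h {suc (suc i)} {zero}         ()
∼⇒shift {suc (suc N)} b h {zero}        {suc zero}     _ t = Equivalence.from T-∨ (inj₁ t)
∼⇒shift               b h {suc zero}    {zero}         _ t = Equivalence.from T-∨ (inj₂ t)
∼⇒shift {suc (suc N)} b h {suc i}       {suc i'}       e t = ∼⇒shift (h zero) (h ∘ suc) e t

PathDominating : ∀ {N} → (Fin N → Bool) → Set
PathDominating h = ∀ i → T (h i) ⊎ ∃[ i' ] i ∼ i' × T (h i')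

PathDominating⇒≤3*count : ∀ {N} (h : Fin N → Bool) → PathDominating h → N ≤ 3 * count h
PathDominating⇒≤3*count {N} h dom = begin
  N                                        ≡⟨ count-all closedNbhd covered ⟨
  count closedNbhd                         ≤⟨ count-∨ h _ ⟩
  count h + count (λ i → left i ∨ right i) ≤⟨ +-monoʳ-≤ (count h) (count-∨ left right) ⟩
  count h + (count left + count right)     ≤⟨ +-monoʳ-≤ (count h) (+-mono-≤ (count-shiftLeft h)
                                                                            (count-shiftRight false h)) ⟩
  count h + (count h + count h)            ≡⟨ cong (λ c → count h + (count h + c)) (+-identityʳ (count h)) ⟨
  3 * count h                              ∎
  where
  open ≤-Reasoning
  left right closedNbhd : Fin N → Bool
  left       = shiftLeft h
  right      = shiftRight false h
  closedNbhd = λ i → h i ∨ (left i ∨ right i)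
  covered : ∀ i → T (closedNbhd i)
  covered i with dom i
  ... | inj₁ t             = Equivalence.from T-∨ (inj₁ t)
  ... | inj₂ (_ , i∼i' , t) = Equivalence.from (T-∨ {h i}) (inj₂ (∼⇒shift false h i∼i' t))

≤3*⇒ceil3≤ : ∀ {N c} → N ≤ 3 * c → ceil3 N ≤ c
≤3*⇒ceil3≤ {N} {c} N≤3c = s≤s⁻¹ (m<n*o⇒m/o<n (begin-strict
  N + 2    <⟨ +-monoʳ-< N (n<1+n 2) ⟩
  N + 3    ≡⟨ +-comm N 3 ⟩
  3 + N    ≤⟨ +-monoʳ-≤ 3 (≤-trans N≤3c (≤-reflexive (*-comm 3 c))) ⟩
  3 + c * 3 ∎))
  where open ≤-Reasoning

AtMostOneNeighbour : ∀ {N} → Fin N → Set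
AtMostOneNeighbour j = ∀ {a c} → j ∼ a → j ∼ c → a ≡ c

atMostOneNeighbour-zero : ∀ {n} → AtMostOneNeighbour {suc n} zero
atMostOneNeighbour-zero {a = a} {c} 0∼a 0∼c =
  toℕ-injective (trans (toℕ≡1 a 0∼a) (sym (toℕ≡1 c 0∼c)))
  where
  toℕ≡1 : ∀ x → zero ∼ x → toℕ x ≡ 1
  toℕ≡1 x 0∼x = trans (sym (dist-zeroˡ (toℕ x))) 0∼x

atMostOneNeighbour-fromℕ : ∀ n → AtMostOneNeighbour (fromℕ n)
atMostOneNeighbour-fromℕ n {a} {c} n∼a n∼c =
  toℕ-injective (suc-injective (trans (suc-toℕ≡n a n∼a) (sym (suc-toℕ≡n c n∼c))))
  where
  suc-toℕ≡n : ∀ x → fromℕ n ∼ x → suc (toℕ x) ≡ n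
  suc-toℕ≡n x n∼x =
    dist≡1⇒suc≡ n (toℕ x) (toℕ≤pred[n] x) (subst (λ k → dist k (toℕ x) ≡ 1) (toℕ-fromℕ n) n∼x)

TwoDominating⇒column-PathDominating : ∀ {m n} (D : VSet m n) → TwoDominating D →
  (j : Fin n) → AtMostOneNeighbour j → PathDominating (λ i → D i j)
TwoDominating⇒column-PathDominating {m} {n} D 2dom j j≤1 i with T? (D i j)
... | yes i∈D = inj₁ i∈D
... | no  i∉D with any? (λ i' → (dist (toℕ i) (toℕ i') ℕ.≟ 1) ×-dec T? (D i' j))
...   | yes nbr = inj₂ nbr
...   | no  ∄nbr = ⊥-elim (<⇒≱ (2dom (i , j) i∉D) atMostOneDNeighbour)
  where
  horizontal : ∀ i' j' → dist (toℕ i) (toℕ i') + dist (toℕ j) (toℕ j') ≡ 1 →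
               D i' j' ≡ true → i' ≡ i × j ∼ j'
  horizontal i' j' e d with m+n≡1-cases _ _ e
  ... | inj₂ (i≡i' , j∼j') = sym (toℕ-dist≡0⇒≡ i≡i') , j∼j'
  ... | inj₁ (i∼i' , j≡j') with refl ← toℕ-dist≡0⇒≡ {a = j} {j'} j≡j' =
    ⊥-elim (∄nbr (i' , i∼i' , subst T (sym d) tt))
  atMostOneDNeighbour : nbrsIn D (i , j) ≤ 1
  atMostOneDNeighbour = length-filter≤1 _ (cartesianProduct⁺ (allFin⁺ m) (allFin⁺ n))
    λ { {i' , j'} {i'' , j''} (e , d) (e' , d') →
          sameVertex (horizontal i' j' e d) (horizontal i'' j'' e' d') }
    where
    sameVertex : ∀ {i' j' i'' j''} → i' ≡ i × j ∼ j' → i'' ≡ i × j ∼ j'' → (i' , j') ≡ (i'' , j'')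
    sameVertex (refl , j∼j') (refl , j∼j'') = cong (i ,_) (j≤1 j∼j' j∼j'')

boundaryColumn-bound : ∀ {m n} (D : VSet m n) → TwoDominating D →
                       (j : Fin n) → AtMostOneNeighbour j → ceil3 m ≤ colCount D j
boundaryColumn-bound D 2dom j j≤1 =
  subst (_ ≤_) (sym (length-filter-tabulate (λ i → D i j) (λ i → i)))
    (≤3*⇒ceil3≤ (PathDominating⇒≤3*count _ columnDominating))
  where
  columnDominating : PathDominating (λ i → D i j)
  columnDominating = TwoDominating⇒column-PathDominating D 2dom j j≤1

lemma2 : (m n : ℕ) → (D : VSet (suc m) (suc n)) → TwoDominating D →
           (ceil3 (suc m) ≤ colCount D zero) × (ceil3 (suc m) ≤ colCount D (fromℕ n))
lemma2 m n D 2dom = boundaryColumn-bound D 2dom zero atMostOneNeighbour-zero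
                  , boundaryColumn-bound D 2dom (fromℕ n) (atMostOneNeighbour-fromℕ n)
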